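{- Let $p$ be a prime, $m$ a positive integer divisible by $3$, $n=\frac m3(p-1)$, $U=[0,n]^2$. Let $J,K,L$ be ideals of $U$ and let $b,c$ be positive integers. If $\bigl[J+D+(0,-b)\bigr]\cap U\subseteq K$ and $\bigl[K+D+(0,-c)\bigr]\cap U\subseteq L$, then $\bigl[J+D+(0,-b-c)\bigr]\cap U\subseteq L$.
   Context: $D=\{(x,y)\in\mathbb{R}^2: x+py\le 0,\ p^2x+y\le 0\}$; $u\prec v$ means $u\in v+D$. An ideal of $\Omega\subseteq\mathbb{R}^2$ is $I\subseteq\Omega$ with $u\in I$, $v\in\Omega$, $v\prec u\Rightarrow v\in I$. $[a,b]=\{x\in\mathbb{Z}:a\le x\le b\}$; sums are Minkowski sums. -}

module Defs where

open import Data.Nat as ℕ using (ℕ)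
open import Data.Integer using (ℤ; +_; _+_; _-_; _*_; _≤_; -_)
open import Data.Product using (_×_; _,_; ∃)
open import Relation.Unary using (Pred; _⊆_)
open import Level using (0ℓ)

Point : Set
Point = ℤ × ℤ

_⊕_ : Point → Point → Point
(a , b) ⊕ (c , d) = (a + c , b + d)

_⊖_ : Point → Point → Point
(a , b) ⊖ (c , d) = (a - c , b - d)

D : ℕ → Pred Point 0ℓ
D p (x , y) = (x + (+ p) * y ≤ + 0) × ((+ p) * (+ p) * x + y ≤ + 0)

_≺[_]_ : Point → ℕ → Point → Set
u ≺[ p ] v = D p (u ⊖ v)

Box : ℕ → Pred Point 0ℓ
Box n (x , y) = (+ 0 ≤ x × x ≤ + n) × (+ 0 ≤ y × y ≤ + n)

IsIdeal : ℕ → Pred Point 0ℓ → Pred Point 0ℓ → Set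
IsIdeal p Ω I = (I ⊆ Ω) × (∀ {u v} → I u → Ω v → v ≺[ p ] u → I v)

-- [ I + D + s ] ∩ Ω  (Minkowski sum; membership of lattice point w:
-- w = j + d + s with j ∈ I, d ∈ D, which forces d = w - j - s to be integral)
ShiftCone : ℕ → Pred Point 0ℓ → Point → Pred Point 0ℓ → Pred Point 0ℓ
ShiftCone p I s Ω w = Ω w × ∃ λ j → I j × D p ((w ⊖ j) ⊖ s)

-- Write w = j + d + (0, -b-c) with j ∈ J and d ∈ D. The intermediate point is k = w + (0, c)
-- when it lies in U; otherwise it is slid back onto the top edge of U along (p, -1), i.e.
-- k = w + (0, c) + t (p, -1). Then w - k + (0, c) = t (-p, 1) lies on an edge ray of D, and
-- k - j + (0, b) has the same value of x + p y as d and a nonnegative y-coordinate (k is on the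
-- top edge, j in U). On the half plane y ≥ 0 the inequality x + p y ≤ 0 implies p² x + y ≤ 0,
-- so both steps are in D, and the two hypotheses carry w ∈ L through k ∈ K.

module Submission where

open import Defs
open import Data.Nat using (ℕ; _≤_; _/_; _*_; _∸_; zero; suc; z≤n) renaming (_+_ to _+ℕ_)
open import Data.Nat.Divisibility using (_∣_)
open import Data.Nat.Primality using (Prime; prime⇒nonZero)
open import Data.Integer as ℤ using (ℤ; +_; -_; 0ℤ; 1ℤ; +≤+)
open import Data.Integer.Properties as ℤ
  using (≤-refl; ≤-reflexive; ≤-trans; +-mono-≤; neg-mono-≤; neg-≤-pos; *-monoʳ-≤-nonNeg;
         *-monoˡ-≤-nonNeg; *-zeroʳ; i≤i+j; i≤j⇒0≤j-i; i-j≤0⇒i≤j; +-identityʳ; pos-+; ≰⇒>; <⇒≤;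
         module ≤-Reasoning)
open import Data.Integer.Tactic.RingSolver using (solve-∀)
open import Data.Product using (_,_; _×_; ∃; proj₁)
open import Relation.Unary using (Pred; _⊆_)
open import Relation.Binary.PropositionalEquality using (_≡_; cong; cong₂; subst; sym)
open import Relation.Nullary using (yes; no)
open import Level using (0ℓ)

module _ (q : ℕ) where

  private
    P : ℤ
    P = + suc q

  x+py≤0∧0≤y⇒D : ∀ {x y} → x ℤ.+ P ℤ.* y ℤ.≤ 0ℤ → 0ℤ ℤ.≤ y → D (suc q) (x , y)
  x+py≤0∧0≤y⇒D {x} {y} ℓ≤0 0≤y = ℓ≤0 , (begin
    P ℤ.* P ℤ.* x ℤ.+ y
      ≡⟨ identity P x y ⟩
    (x ℤ.+ P ℤ.* y) ℤ.* (P ℤ.* P) ℤ.- y ℤ.* (P ℤ.* P ℤ.* P ℤ.- 1ℤ)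
      ≤⟨ +-mono-≤ (*-monoʳ-≤-nonNeg (P ℤ.* P) ℓ≤0)
                  (neg-mono-≤ (*-monoʳ-≤-nonNeg (P ℤ.* P ℤ.* P ℤ.- 1ℤ) 0≤y)) ⟩
    0ℤ ∎)
    where
      open ≤-Reasoning
      identity : ∀ p x y → p ℤ.* p ℤ.* x ℤ.+ y ≡
                 (x ℤ.+ p ℤ.* y) ℤ.* (p ℤ.* p) ℤ.- y ℤ.* (p ℤ.* p ℤ.* p ℤ.- 1ℤ)
      identity = solve-∀

  D∧0≤y⇒x≤0 : ∀ {x y} → D (suc q) (x , y) → 0ℤ ℤ.≤ y → x ℤ.≤ 0ℤ
  D∧0≤y⇒x≤0 {x} {y} (ℓ≤0 , _) 0≤y =
    ≤-trans (i≤i+j x (P ℤ.* y) {{ℤ.nonNegative 0≤py}}) ℓ≤0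
    where
      0≤py : 0ℤ ℤ.≤ P ℤ.* y
      0≤py = subst (ℤ._≤ P ℤ.* y) (*-zeroʳ P) (*-monoˡ-≤-nonNeg P 0≤y)

  ray∈D : ∀ {t} → 0ℤ ℤ.≤ t → D (suc q) (- (t ℤ.* P) , t)
  ray∈D {t} 0≤t = x+py≤0∧0≤y⇒D {x = - (t ℤ.* P)} (≤-reflexive (on-boundary t P)) 0≤t
    where
      on-boundary : ∀ t p → - (t ℤ.* p) ℤ.+ p ℤ.* t ≡ 0ℤ
      on-boundary = solve-∀

  shift-factors-in-Box : ∀ n b c {w j} → Box n w → Box n j →
    D (suc q) ((w ⊖ j) ⊖ (+ 0 , - (+ b ℤ.+ + c))) →
    ∃ λ k → Box n k × D (suc q) ((k ⊖ j) ⊖ (+ 0 , - (+ b)))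
                    × D (suc q) ((w ⊖ k) ⊖ (+ 0 , - (+ c)))
  shift-factors-in-Box n b c {wx , wy} {jx , jy}
    ((0≤wx , wx≤n) , (0≤wy , _)) ((_ , jx≤n) , (_ , jy≤n)) d∈D with wy ℤ.+ + c ℤ.≤? + n
  ... | yes wy+c≤n =
    (wx , wy ℤ.+ + c) , ((0≤wx , wx≤n) , (+-mono-≤ 0≤wy (+≤+ z≤n) , wy+c≤n)) ,
    subst (D (suc q)) (cong ((wx ℤ.- jx) ℤ.- 0ℤ ,_) (regroup wy jy (+ b) (+ c))) d∈D ,
    subst (D (suc q)) (cong₂ _,_ (sym (cancel-x wx)) (sym (cancel-y wy (+ c)))) (ray∈D ≤-refl)
    where
      regroup : ∀ wy jy b c → (wy ℤ.- jy) ℤ.- - (b ℤ.+ c) ≡ ((wy ℤ.+ c) ℤ.- jy) ℤ.- - b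
      regroup = solve-∀
      cancel-x : ∀ x → (x ℤ.- x) ℤ.- 0ℤ ≡ 0ℤ
      cancel-x = solve-∀
      cancel-y : ∀ y c → (y ℤ.- (y ℤ.+ c)) ℤ.- - c ≡ 0ℤ
      cancel-y = solve-∀
  ... | no wy+c≰n = k , ((0≤kx , kx≤n) , (+≤+ z≤n , ≤-refl)) , k-j∈D , w-k∈D
    where
      t : ℤ
      t = (wy ℤ.+ + c) ℤ.- + n
      0≤t : 0ℤ ℤ.≤ t
      0≤t = i≤j⇒0≤j-i (<⇒≤ (≰⇒> wy+c≰n))
      k : Point
      k = (wx ℤ.+ t ℤ.* P , + n)
      0≤kx : 0ℤ ℤ.≤ wx ℤ.+ t ℤ.* P
      0≤kx = +-mono-≤ 0≤wx (*-monoʳ-≤-nonNeg P 0≤t)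
      0≤n-jy+b : 0ℤ ℤ.≤ (+ n ℤ.- jy) ℤ.- - (+ b)
      0≤n-jy+b = i≤j⇒0≤j-i (≤-trans neg-≤-pos (i≤j⇒0≤j-i jy≤n))
      same-ℓ : ∀ p n b c wx wy jx jy →
        (wx ℤ.- jx) ℤ.- 0ℤ ℤ.+ p ℤ.* ((wy ℤ.- jy) ℤ.- - (b ℤ.+ c)) ≡
        ((wx ℤ.+ ((wy ℤ.+ c) ℤ.- n) ℤ.* p) ℤ.- jx) ℤ.- 0ℤ ℤ.+ p ℤ.* ((n ℤ.- jy) ℤ.- - b)
      same-ℓ = solve-∀
      k-j∈D : D (suc q) ((k ⊖ (jx , jy)) ⊖ (+ 0 , - (+ b)))
      k-j∈D = x+py≤0∧0≤y⇒D {x = ((wx ℤ.+ t ℤ.* P) ℤ.- jx) ℤ.- 0ℤ}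
        (subst (ℤ._≤ 0ℤ) (same-ℓ P (+ n) (+ b) (+ c) wx wy jx jy) (proj₁ d∈D)) 0≤n-jy+b
      kx≤n : wx ℤ.+ t ℤ.* P ℤ.≤ + n
      kx≤n = ≤-trans (i-j≤0⇒i≤j (subst (ℤ._≤ 0ℤ) (+-identityʳ _) (D∧0≤y⇒x≤0 k-j∈D 0≤n-jy+b))) jx≤n
      edge-x : ∀ p n c wx wy →
        - (((wy ℤ.+ c) ℤ.- n) ℤ.* p) ≡ (wx ℤ.- (wx ℤ.+ ((wy ℤ.+ c) ℤ.- n) ℤ.* p)) ℤ.- 0ℤ
      edge-x = solve-∀
      edge-y : ∀ n c wy → (wy ℤ.+ c) ℤ.- n ≡ (wy ℤ.- n) ℤ.- - c
      edge-y = solve-∀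
      w-k∈D : D (suc q) (((wx , wy) ⊖ k) ⊖ (+ 0 , - (+ c)))
      w-k∈D = subst (D (suc q)) (cong₂ _,_ (edge-x P (+ n) (+ c) wx wy) (edge-y (+ n) (+ c) wy))
                    (ray∈D 0≤t)

lemma4p3 : (p m : ℕ) → Prime p → 1 ≤ m → 3 ∣ m →
    (J K L : Pred Point 0ℓ) → (b c : ℕ) → 1 ≤ b → 1 ≤ c →
    let n = (m / 3) * (p ∸ 1) in
    IsIdeal p (Box n) J → IsIdeal p (Box n) K → IsIdeal p (Box n) L →
    ShiftCone p J (+ 0 , - (+ b)) (Box n) ⊆ K →
    ShiftCone p K (+ 0 , - (+ c)) (Box n) ⊆ L →
    ShiftCone p J (+ 0 , - (+ (b +ℕ c))) (Box n) ⊆ L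
lemma4p3 zero _ p-prime with prime⇒nonZero p-prime
... | ()
lemma4p3 (suc q) m _ _ _ _ _ _ b c _ _ (J⊆U , _) _ _ J→K K→L {w} (w∈U , j , j∈J , w-j∈D)
  with shift-factors-in-Box q ((m / 3) * q) b c w∈U (J⊆U j∈J)
         (subst (λ s → D (suc q) ((w ⊖ j) ⊖ (+ 0 , - s))) (pos-+ b c) w-j∈D)
... | k , k∈U , k-j∈D , w-k∈D = K→L (w∈U , k , J→K (k∈U , j , j∈J , k-j∈D) , w-k∈D)
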